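{- Let $\Gamma$ be a cubical subdivision of a $d$-dimensional cube $C$ with subdivision map $\sigma$, and let $\Gamma'$ be a cubical subdivision of a $d'$-dimensional cube $C'$ with subdivision map $\sigma'$. Regard $\Gamma\times\Gamma'$ as a cubical subdivision of the $(d+d')$-dimensional cube $C\times C'$ by declaring the carrier of a face $G\times G'$ to be $\sigma(G)\times\sigma'(G')$. Then $\ell_{C\times C'}(\Gamma\times\Gamma',x)=\ell_C(\Gamma,x)\,\ell_{C'}(\Gamma',x)$.
   Context: A $d$-dimensional (abstract) cube is a poset isomorphic to the poset of all faces (including the empty face) of $[0,1]^d$. A cubical complex is a finite poset $K$ with a minimum element $\varnothing$ (the empty face) such that every interval $[\varnothing,F]$ is a cube and any two elements have a greatest lower bound; elements are faces, $\dim F$ is the dimension of the cube $[\varnothing,F]$, $\dim K$ is the maximum face dimension, $\mathcal F(K)$ is the set of nonempty faces, subcomplexes are nonempty order ideals, and topological properties refer to the order complex of $\mathcal F(K)$. A face $F$ is regarded as the cubical complex $[\varnothing,F]$. For cubical complexes $K,K'$, the product $K\times K'$ is the cubical complex whose poset of nonempty faces is $\mathcal F(K)\times\mathcal F(K')$ (product order), with an empty face adjoined, and $\dim(F\times F')=\dim F+\dim F'$. A cubical subdivision of a cubical complex $K$ is a cubical complex $K'$ with a map $\sigma:\mathcal F(K')\to\mathcal F(K)$ such that for every $F\in\mathcal F(K)$: (a) $K'_F:=\sigma^{ -1}(\{G\in\mathcal F(K):G\le F\})\cup\{\varnothing\}$ is a subcomplex of $K'$ homeomorphic to a ball of dimension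 $\dim F$; (b) $\sigma^{ -1}(F)$ is the set of interior faces of this ball. $K'_F$ is regarded as a cubical subdivision of the cube $F$; $\sigma(G)$ is the carrier of $G$. Short cubical $h$-polynomial of a $d$-dimensional cubical complex $K$: $h^{(sc)}(K,x)=\sum_{F\in K\setminus\{\varnothing\}}(2x)^{\dim F}(1-x)^{d-\dim F}$. For a cubical subdivision $\Gamma$ of a $d$-dimensional cube $C$: $\ell_C(\Gamma,x)=\sum_{F\in\mathcal F(C)}(-1)^{d-\dim F}h^{(sc)}(\Gamma_F,x)$, with $\Gamma_F$ of dimension $\dim F$. -}

module Defs where

open import Data.Nat as ℕ using (ℕ; zero; suc; _∸_) renaming (_+_ to _+ℕ_; _≤_ to _≤ℕ_)
open import Data.Integer using (ℤ; +_; -_; _+_; _-_; _*_; _^_)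
open import Data.Bool using (Bool; true; false; _∧_; if_then_else_)
open import Data.Vec using (Vec; []; _∷_; _++_)
open import Data.List using (List; []; _∷_; map; foldr; concatMap; cartesianProduct; length; filter)
open import Data.List.Membership.Propositional using (_∈_)
open import Data.List.Relation.Unary.Unique.Propositional using (Unique)
open import Data.Maybe using (Maybe; just; nothing)
open import Data.Product using (Σ; _×_; _,_; proj₁; ∃)
open import Data.Empty using (⊥)
open import Relation.Nullary using (¬_)
open import Relation.Nullary.Decidable using (⌊_⌋)
open import Relation.Binary.PropositionalEquality using (_≡_)
open import Function.Bundles using (_⇔_)

-- The standard d-cube [0,1]^d.  A nonempty face is a word in {0,1,*}^d;
-- the empty face is represented separately (by `nothing` below).

data Tri : Set where
  𝟘 𝟙 ⋆ : Tri

triLeq : Tri → Tri → Bool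
triLeq _ ⋆ = true
triLeq 𝟘 𝟘 = true
triLeq 𝟙 𝟙 = true
triLeq _ _ = false

cubeLeq : ∀ {d} → Vec Tri d → Vec Tri d → Bool
cubeLeq [] [] = true
cubeLeq (a ∷ u) (b ∷ v) = triLeq a b ∧ cubeLeq u v

cubeDim : ∀ {d} → Vec Tri d → ℕ
cubeDim [] = 0
cubeDim (⋆ ∷ u) = suc (cubeDim u)
cubeDim (_ ∷ u) = cubeDim u

allTri : List Tri
allTri = 𝟘 ∷ 𝟙 ∷ ⋆ ∷ []

cubeFaces : (d : ℕ) → List (Vec Tri d)
cubeFaces zero = [] ∷ []
cubeFaces (suc d) = concatMap (λ v → map (λ a → a ∷ v) allTri) (cubeFaces d)

record OrderIso {A B : Set} (_≤A_ : A → A → Bool) (_≤B_ : B → B → Bool) : Set where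
  field
    to      : A → B
    from    : B → A
    from-to : ∀ a → from (to a) ≡ a
    to-from : ∀ b → to (from b) ≡ b
    mono    : ∀ a a' → (a ≤A a') ≡ (to a ≤B to a')

-- Cubical complexes.  `Face` is the (finite) type of NONEMPTY faces; the
-- empty face is adjoined as `nothing` in `Maybe Face`.

liftLeq : {A : Set} → (A → A → Bool) → Maybe A → Maybe A → Bool
liftLeq _ nothing _ = true
liftLeq _ (just _) nothing = false
liftLeq _≤_ (just F) (just G) = F ≤ G

record CubicalComplex : Set₁ where
  field
    Face         : Set
    faces        : List Face
    faces-all    : ∀ F → F ∈ faces
    faces-unique : Unique faces
    _≼_          : Face → Face → Bool
    ≼-refl       : ∀ F → (F ≼ F) ≡ true
    ≼-antisym    : ∀ F G → (F ≼ G) ≡ true → (G ≼ F) ≡ true → F ≡ G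
    ≼-trans      : ∀ F G H → (F ≼ G) ≡ true → (G ≼ H) ≡ true → (F ≼ H) ≡ true
    dim          : Face → ℕ
  Below : Face → Set
  Below F = Σ Face (λ G → (G ≼ F) ≡ true)
  _≼∅_ : Maybe Face → Maybe Face → Bool
  _≼∅_ = liftLeq _≼_
  field
    -- every interval [∅,F] (F nonempty) is a cube of dimension dim F
    -- (an order isomorphism of nonempty parts extends uniquely by ∅ ↦ ∅)
    interval-cube : ∀ F → OrderIso {Below F} {Vec Tri (dim F)}
                            (λ G H → proj₁ G ≼ proj₁ H) cubeLeq
    meet : ∀ (x y : Maybe Face) → Σ (Maybe Face) λ m →
             (m ≼∅ x) ≡ true × (m ≼∅ y) ≡ true ×
             (∀ z → (z ≼∅ x) ≡ true → (z ≼∅ y) ≡ true → (z ≼∅ m) ≡ true)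

open CubicalComplex public

-- Subcomplexes given by a Bool predicate on nonempty faces (∅ always in).

IsOrderIdeal : (K : CubicalComplex) → (Face K → Bool) → Set
IsOrderIdeal K S = ∀ G H → (_≼_ K H G) ≡ true → S G ≡ true → S H ≡ true

countIn : (K : CubicalComplex) → (Face K → Bool) → ℕ
countIn K P = length (filter (λ G → P G Data.Bool.≟ true) (faces K))
  where import Data.Bool

IsBoundaryFace : (K : CubicalComplex) → (Face K → Bool) → ℕ → Face K → Set
IsBoundaryFace K S e G =
  Σ (Face K) λ R → S R ≡ true × suc (dim K R) ≡ e × (_≼_ K G R) ≡ true ×
    countIn K (λ T → S T ∧ ⌊ dim K T ℕ.≟ e ⌋ ∧ _≼_ K R T) ≡ 1

IsInteriorFace : (K : CubicalComplex) → (Face K → Bool) → ℕ → Face K → Set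
IsInteriorFace K S e G = S G ≡ true × ¬ IsBoundaryFace K S e G

-- A notion "the subcomplex S of K is homeomorphic to a ball of dimension e"
-- (topological; not expressible in agda-stdlib, so kept abstract).
BallPredicate : Set₁
BallPredicate = (K : CubicalComplex) → (Face K → Bool) → ℕ → Set

record CubicalSubdivision (IsBall : BallPredicate) (d : ℕ) : Set₁ where
  field
    K : CubicalComplex
    σ : Face K → Vec Tri d
  restr : Vec Tri d → Face K → Bool
  restr F G = cubeLeq (σ G) F
  field
    restr-ideal : ∀ F → IsOrderIdeal K (restr F)
    restr-ball  : ∀ F → IsBall K (restr F) (cubeDim F)
    -- (a') consequence of (a): faces of K_F have dimension ≤ dim F
    dim-carrier : ∀ G → dim K G ≤ℕ cubeDim (σ G)
    carrier-interior : ∀ F G → (σ G ≡ F) ⇔ IsInteriorFace K (restr F) (cubeDim F) G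

record CarrierData (d : ℕ) : Set₁ where
  field
    CFace    : Set
    cfaces   : List CFace
    cdim     : CFace → ℕ
    carrier  : CFace → Vec Tri d

toCarrierData : ∀ {IsBall d} → CubicalSubdivision IsBall d → CarrierData d
toCarrierData Γ = record
  { CFace = Face K ; cfaces = faces K ; cdim = dim K ; carrier = σ }
  where open CubicalSubdivision Γ

-- Product Γ × Γ' with carrier σ(G) × σ'(G'); the face F × F' of C × C'
-- is identified with the face F ++ F' of the standard (d+d')-cube.
productData : ∀ {d d'} → CarrierData d → CarrierData d' → CarrierData (d +ℕ d')
productData Γ Γ' = record
  { CFace   = CarrierData.CFace Γ × CarrierData.CFace Γ'
  ; cfaces  = cartesianProduct (CarrierData.cfaces Γ) (CarrierData.cfaces Γ')
  ; cdim    = λ { (G , G') → CarrierData.cdim Γ G +ℕ CarrierData.cdim Γ' G' }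
  ; carrier = λ { (G , G') → CarrierData.carrier Γ G ++ CarrierData.carrier Γ' G' }
  }

-- Polynomials are represented by their evaluation at an integer x.

sumℤ : List ℤ → ℤ
sumℤ = foldr _+_ (+ 0)

hscRestr : ∀ {d} → CarrierData d → Vec Tri d → ℤ → ℤ
hscRestr Γ F x = sumℤ (map term (CarrierData.cfaces Γ))
  where
  term : CarrierData.CFace Γ → ℤ
  term G = if cubeLeq (CarrierData.carrier Γ G) F
           then ((+ 2 * x) ^ CarrierData.cdim Γ G) * ((+ 1 - x) ^ (cubeDim F ∸ CarrierData.cdim Γ G))
           else + 0

localH : ∀ {d} → CarrierData d → ℤ → ℤ
localH {d} Γ x = sumℤ (map (λ F → ((- + 1) ^ (d ∸ cubeDim F)) * hscRestr Γ F x) (cubeFaces d))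

-- Both sides are finite double sums, and everything in the summand factors over the
-- product.  The faces of C × C' are exactly the pairs F ++ F'; the sign (-1)^(d+d'-dim)
-- is a product of signs; and the carrier condition σ(G) ++ σ'(G') ≤ F ++ F' holds iff
-- σ(G) ≤ F and σ'(G') ≤ F', so h^(sc)((Γ×Γ')_{F×F'}) = h^(sc)(Γ_F) · h^(sc)(Γ'_{F'})
-- term by term, since (2x)^g (1-x)^(f-g) is multiplicative in the pair (g, f).
module Submission where

open import Defs
open import Data.Nat using (ℕ; zero; suc; _∸_; z≤n; s≤s) renaming (_+_ to _+ℕ_; _≤_ to _≤ℕ_)
open import Data.Nat.Properties using (≤-trans; m≤n⇒m≤1+n; ∸-+-assoc; +-∸-comm; +-∸-assoc)
open import Data.Integer using (ℤ; +_; -_; _+_; _-_; _*_; _^_)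
open import Data.Integer.Properties
  using (+-assoc; +-identityˡ; +-identityʳ; *-comm; *-zeroˡ; *-zeroʳ; *-distribˡ-+; ^-distribˡ-+-*;
         +-commutativeSemigroup; *-commutativeSemigroup)
open import Algebra.Properties.CommutativeSemigroup +-commutativeSemigroup
  using () renaming (interchange to +-interchange)
open import Algebra.Properties.CommutativeSemigroup *-commutativeSemigroup
  using () renaming (interchange to *-interchange)
open import Data.Bool using (true; false; _∧_; if_then_else_)
open import Data.Bool.Properties using (∧-assoc)
open import Data.Vec using (Vec; []; _∷_; _++_)
open import Data.List using (List; []; _∷_; map; concatMap; cartesianProduct) renaming (_++_ to _++ᴸ_)
open import Data.Product using (_×_; _,_)
open import Relation.Binary.PropositionalEquality
  using (_≡_; refl; sym; trans; cong; cong₂; module ≡-Reasoning)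

sumOver : {A : Set} → List A → (A → ℤ) → ℤ
sumOver l f = sumℤ (map f l)

infix 5 sumOver
syntax sumOver l (λ a → e) = ∑[ a ∈ l ] e

sumOver-cong : {A : Set} (l : List A) {f g : A → ℤ} → (∀ a → f a ≡ g a) → sumOver l f ≡ sumOver l g
sumOver-cong []      f≗g = refl
sumOver-cong (a ∷ l) f≗g = cong₂ _+_ (f≗g a) (sumOver-cong l f≗g)

sumOver-zero : {A : Set} (l : List A) → ∑[ a ∈ l ] + 0 ≡ + 0
sumOver-zero []      = refl
sumOver-zero (_ ∷ l) = trans (+-identityˡ _) (sumOver-zero l)

sumOver-++ : {A : Set} (l l' : List A) (f : A → ℤ) → sumOver (l ++ᴸ l') f ≡ sumOver l f + sumOver l' f
sumOver-++ []      l' f = sym (+-identityˡ _)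
sumOver-++ (a ∷ l) l' f = trans (cong (_+_ (f a)) (sumOver-++ l l' f)) (sym (+-assoc (f a) _ _))

sumOver-map : {A B : Set} (h : A → B) (l : List A) (f : B → ℤ) →
  sumOver (map h l) f ≡ ∑[ a ∈ l ] f (h a)
sumOver-map h []      f = refl
sumOver-map h (a ∷ l) f = cong (_+_ (f (h a))) (sumOver-map h l f)

sumOver-+ : {A : Set} (l : List A) (f g : A → ℤ) →
  ∑[ a ∈ l ] (f a + g a) ≡ sumOver l f + sumOver l g
sumOver-+ []      f g = refl
sumOver-+ (a ∷ l) f g =
  trans (cong (_+_ (f a + g a)) (sumOver-+ l f g)) (+-interchange (f a) (g a) _ _)

*-distribˡ-sumOver : {A : Set} (c : ℤ) (l : List A) (f : A → ℤ) →
  c * sumOver l f ≡ ∑[ a ∈ l ] (c * f a)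
*-distribˡ-sumOver c []      f = *-zeroʳ c
*-distribˡ-sumOver c (a ∷ l) f =
  trans (*-distribˡ-+ c (f a) _) (cong (_+_ (c * f a)) (*-distribˡ-sumOver c l f))

sumOver-concatMap : {A B : Set} (h : A → List B) (l : List A) (f : B → ℤ) →
  sumOver (concatMap h l) f ≡ ∑[ a ∈ l ] sumOver (h a) f
sumOver-concatMap h []      f = refl
sumOver-concatMap h (a ∷ l) f =
  trans (sumOver-++ (h a) (concatMap h l) f) (cong (_+_ (sumOver (h a) f)) (sumOver-concatMap h l f))

sumOver-cartesianProduct : {A B : Set} (l : List A) (l' : List B) (f : A × B → ℤ) →
  sumOver (cartesianProduct l l') f ≡ ∑[ a ∈ l ] ∑[ b ∈ l' ] f (a , b)
sumOver-cartesianProduct []      l' f = refl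
sumOver-cartesianProduct (a ∷ l) l' f =
  trans (sumOver-++ (map (a ,_) l') _ f)
        (cong₂ _+_ (sumOver-map (a ,_) l' f) (sumOver-cartesianProduct l l' f))

sumOver-comm : {A B : Set} (l : List A) (l' : List B) (f : A → B → ℤ) →
  ∑[ a ∈ l ] ∑[ b ∈ l' ] f a b ≡ ∑[ b ∈ l' ] ∑[ a ∈ l ] f a b
sumOver-comm []      l' f = sym (sumOver-zero l')
sumOver-comm (a ∷ l) l' f =
  trans (cong (_+_ (sumOver l' (f a))) (sumOver-comm l l' f)) (sym (sumOver-+ l' (f a) _))

sumOver-*-sumOver : {A B : Set} (l : List A) (l' : List B) (f : A → ℤ) (g : B → ℤ) →
  ∑[ a ∈ l ] ∑[ b ∈ l' ] (f a * g b) ≡ sumOver l f * sumOver l' g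
sumOver-*-sumOver l l' f g = begin
  ∑[ a ∈ l ] ∑[ b ∈ l' ] (f a * g b)  ≡⟨ sumOver-cong l (λ a → sym (*-distribˡ-sumOver (f a) l' g)) ⟩
  ∑[ a ∈ l ] (f a * sumOver l' g)     ≡⟨ sumOver-cong l (λ a → *-comm (f a) _) ⟩
  ∑[ a ∈ l ] (sumOver l' g * f a)     ≡⟨ sym (*-distribˡ-sumOver (sumOver l' g) l f) ⟩
  sumOver l' g * sumOver l f          ≡⟨ *-comm (sumOver l' g) _ ⟩
  sumOver l f * sumOver l' g          ∎
  where open ≡-Reasoning

sumOver-cubeFaces-+ : ∀ d d' (f : Vec Tri (d +ℕ d') → ℤ) →
  sumOver (cubeFaces (d +ℕ d')) f ≡ ∑[ u ∈ cubeFaces d ] ∑[ w ∈ cubeFaces d' ] f (u ++ w)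
sumOver-cubeFaces-+ zero    d' f = sym (+-identityʳ _)
sumOver-cubeFaces-+ (suc d) d' f = begin
  sumOver (cubeFaces (suc (d +ℕ d'))) f
    ≡⟨ sumOver-concatMap extend (cubeFaces (d +ℕ d')) f ⟩
  ∑[ v ∈ cubeFaces (d +ℕ d') ] ∑[ a ∈ allTri ] f (a ∷ v)
    ≡⟨ sumOver-cubeFaces-+ d d' _ ⟩
  ∑[ u ∈ cubeFaces d ] ∑[ w ∈ cubeFaces d' ] ∑[ a ∈ allTri ] f (a ∷ (u ++ w))
    ≡⟨ sumOver-cong (cubeFaces d) (λ u → sumOver-comm (cubeFaces d') allTri (λ w a → f (a ∷ (u ++ w)))) ⟩
  ∑[ u ∈ cubeFaces d ] ∑[ a ∈ allTri ] ∑[ w ∈ cubeFaces d' ] f (a ∷ (u ++ w))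
    ≡⟨ sym (sumOver-concatMap extend (cubeFaces d) _) ⟩
  ∑[ u ∈ cubeFaces (suc d) ] ∑[ w ∈ cubeFaces d' ] f (u ++ w)
    ∎
  where
  open ≡-Reasoning
  extend : ∀ {n} → Vec Tri n → List (Vec Tri (suc n))
  extend v = map (_∷ v) allTri

cubeLeq-++ : ∀ {d d'} (u u' : Vec Tri d) (w w' : Vec Tri d') →
  cubeLeq (u ++ w) (u' ++ w') ≡ (cubeLeq u u' ∧ cubeLeq w w')
cubeLeq-++ []      []       w w' = refl
cubeLeq-++ (a ∷ u) (b ∷ u') w w' =
  trans (cong (triLeq a b ∧_) (cubeLeq-++ u u' w w')) (sym (∧-assoc (triLeq a b) _ _))

cubeDim-++ : ∀ {d d'} (u : Vec Tri d) (w : Vec Tri d') → cubeDim (u ++ w) ≡ cubeDim u +ℕ cubeDim w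
cubeDim-++ []      w = refl
cubeDim-++ (𝟘 ∷ u) w = cubeDim-++ u w
cubeDim-++ (𝟙 ∷ u) w = cubeDim-++ u w
cubeDim-++ (⋆ ∷ u) w = cong suc (cubeDim-++ u w)

cubeDim≤d : ∀ {d} (u : Vec Tri d) → cubeDim u ≤ℕ d
cubeDim≤d []      = z≤n
cubeDim≤d (𝟘 ∷ u) = m≤n⇒m≤1+n (cubeDim≤d u)
cubeDim≤d (𝟙 ∷ u) = m≤n⇒m≤1+n (cubeDim≤d u)
cubeDim≤d (⋆ ∷ u) = s≤s (cubeDim≤d u)

cubeLeq⇒cubeDim≤ : ∀ {d} (u v : Vec Tri d) → cubeLeq u v ≡ true → cubeDim u ≤ℕ cubeDim v
cubeLeq⇒cubeDim≤ []      []      _   = z≤n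
cubeLeq⇒cubeDim≤ (𝟘 ∷ u) (𝟘 ∷ v) u≤v = cubeLeq⇒cubeDim≤ u v u≤v
cubeLeq⇒cubeDim≤ (𝟙 ∷ u) (𝟙 ∷ v) u≤v = cubeLeq⇒cubeDim≤ u v u≤v
cubeLeq⇒cubeDim≤ (𝟘 ∷ u) (⋆ ∷ v) u≤v = m≤n⇒m≤1+n (cubeLeq⇒cubeDim≤ u v u≤v)
cubeLeq⇒cubeDim≤ (𝟙 ∷ u) (⋆ ∷ v) u≤v = m≤n⇒m≤1+n (cubeLeq⇒cubeDim≤ u v u≤v)
cubeLeq⇒cubeDim≤ (⋆ ∷ u) (⋆ ∷ v) u≤v = s≤s (cubeLeq⇒cubeDim≤ u v u≤v)
cubeLeq⇒cubeDim≤ (𝟘 ∷ u) (𝟙 ∷ v) ()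
cubeLeq⇒cubeDim≤ (𝟙 ∷ u) (𝟘 ∷ v) ()
cubeLeq⇒cubeDim≤ (⋆ ∷ u) (𝟘 ∷ v) ()
cubeLeq⇒cubeDim≤ (⋆ ∷ u) (𝟙 ∷ v) ()

[m+n]∸[o+p]≡[m∸o]+[n∸p] : ∀ m n {o p} → o ≤ℕ m → p ≤ℕ n → (m +ℕ n) ∸ (o +ℕ p) ≡ (m ∸ o) +ℕ (n ∸ p)
[m+n]∸[o+p]≡[m∸o]+[n∸p] m n {o} {p} o≤m p≤n = begin
  (m +ℕ n) ∸ (o +ℕ p)  ≡⟨ sym (∸-+-assoc (m +ℕ n) o p) ⟩
  (m +ℕ n) ∸ o ∸ p     ≡⟨ cong (_∸ p) (+-∸-comm n o≤m) ⟩
  (m ∸ o +ℕ n) ∸ p     ≡⟨ +-∸-assoc (m ∸ o) p≤n ⟩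
  (m ∸ o) +ℕ (n ∸ p)   ∎
  where open ≡-Reasoning

-- The bounds g ≤ f and g' ≤ f' are needed because ∸ truncates.
^-*-^-∸-+ : ∀ a b {g g' f f'} → g ≤ℕ f → g' ≤ℕ f' →
  a ^ (g +ℕ g') * b ^ ((f +ℕ f') ∸ (g +ℕ g')) ≡ (a ^ g * b ^ (f ∸ g)) * (a ^ g' * b ^ (f' ∸ g'))
^-*-^-∸-+ a b {g} {g'} {f} {f'} g≤f g'≤f' = begin
  a ^ (g +ℕ g') * b ^ ((f +ℕ f') ∸ (g +ℕ g'))
    ≡⟨ cong (λ n → a ^ (g +ℕ g') * b ^ n) ([m+n]∸[o+p]≡[m∸o]+[n∸p] f f' g≤f g'≤f') ⟩
  a ^ (g +ℕ g') * b ^ ((f ∸ g) +ℕ (f' ∸ g'))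
    ≡⟨ cong₂ _*_ (^-distribˡ-+-* a g g') (^-distribˡ-+-* b (f ∸ g) (f' ∸ g')) ⟩
  (a ^ g * a ^ g') * (b ^ (f ∸ g) * b ^ (f' ∸ g'))
    ≡⟨ *-interchange (a ^ g) (a ^ g') _ _ ⟩
  (a ^ g * b ^ (f ∸ g)) * (a ^ g' * b ^ (f' ∸ g'))
    ∎
  where open ≡-Reasoning

open CarrierData

DimBoundedByCarrier : ∀ {d} → CarrierData d → Set
DimBoundedByCarrier Γ = ∀ G → cdim Γ G ≤ℕ cubeDim (carrier Γ G)

hscTerm : ∀ {d} (Γ : CarrierData d) → Vec Tri d → ℤ → CFace Γ → ℤ
hscTerm Γ F x G = if cubeLeq (carrier Γ G) F
                  then ((+ 2 * x) ^ cdim Γ G) * ((+ 1 - x) ^ (cubeDim F ∸ cdim Γ G))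
                  else + 0

localHSign : ∀ d → Vec Tri d → ℤ
localHSign d F = (- + 1) ^ (d ∸ cubeDim F)

localHSign-++ : ∀ {d d'} (F : Vec Tri d) (F' : Vec Tri d') →
  localHSign (d +ℕ d') (F ++ F') ≡ localHSign d F * localHSign d' F'
localHSign-++ {d} {d'} F F' = begin
  (- + 1) ^ ((d +ℕ d') ∸ cubeDim (F ++ F'))
    ≡⟨ cong (λ n → (- + 1) ^ ((d +ℕ d') ∸ n)) (cubeDim-++ F F') ⟩
  (- + 1) ^ ((d +ℕ d') ∸ (cubeDim F +ℕ cubeDim F'))
    ≡⟨ cong ((- + 1) ^_) ([m+n]∸[o+p]≡[m∸o]+[n∸p] d d' (cubeDim≤d F) (cubeDim≤d F')) ⟩
  (- + 1) ^ ((d ∸ cubeDim F) +ℕ (d' ∸ cubeDim F'))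
    ≡⟨ ^-distribˡ-+-* (- + 1) (d ∸ cubeDim F) (d' ∸ cubeDim F') ⟩
  localHSign d F * localHSign d' F'
    ∎
  where open ≡-Reasoning

module _ {d d'} (Γ : CarrierData d) (Γ' : CarrierData d')
         (Γ-bounded : DimBoundedByCarrier Γ) (Γ'-bounded : DimBoundedByCarrier Γ') (x : ℤ) where

  private
    Γ×Γ' = productData Γ Γ'

  hscTerm-product : ∀ F F' G G' →
    hscTerm Γ×Γ' (F ++ F') x (G , G') ≡ hscTerm Γ F x G * hscTerm Γ' F' x G'
  hscTerm-product F F' G G'
    rewrite cubeLeq-++ (carrier Γ G) F (carrier Γ' G') F' | cubeDim-++ F F'
    with cubeLeq (carrier Γ G) F in G≤F | cubeLeq (carrier Γ' G') F' in G'≤F'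
  ... | false | _     = sym (*-zeroˡ (hscTerm Γ' F' x G'))
  ... | true  | false = sym (*-zeroʳ ((+ 2 * x) ^ cdim Γ G * (+ 1 - x) ^ (cubeDim F ∸ cdim Γ G)))
  ... | true  | true  = ^-*-^-∸-+ (+ 2 * x) (+ 1 - x)
    (≤-trans (Γ-bounded G) (cubeLeq⇒cubeDim≤ (carrier Γ G) F G≤F))
    (≤-trans (Γ'-bounded G') (cubeLeq⇒cubeDim≤ (carrier Γ' G') F' G'≤F'))

  hscRestr-product : ∀ F F' → hscRestr Γ×Γ' (F ++ F') x ≡ hscRestr Γ F x * hscRestr Γ' F' x
  hscRestr-product F F' = begin
    sumOver (cfaces Γ×Γ') (hscTerm Γ×Γ' (F ++ F') x)
      ≡⟨ sumOver-cartesianProduct (cfaces Γ) (cfaces Γ') _ ⟩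
    ∑[ G ∈ cfaces Γ ] ∑[ G' ∈ cfaces Γ' ] hscTerm Γ×Γ' (F ++ F') x (G , G')
      ≡⟨ sumOver-cong (cfaces Γ) (λ G → sumOver-cong (cfaces Γ') (hscTerm-product F F' G)) ⟩
    ∑[ G ∈ cfaces Γ ] ∑[ G' ∈ cfaces Γ' ] (hscTerm Γ F x G * hscTerm Γ' F' x G')
      ≡⟨ sumOver-*-sumOver (cfaces Γ) (cfaces Γ') _ _ ⟩
    hscRestr Γ F x * hscRestr Γ' F' x
      ∎
    where open ≡-Reasoning

  localH-product : localH Γ×Γ' x ≡ localH Γ x * localH Γ' x
  localH-product = begin
    ∑[ F ∈ cubeFaces (d +ℕ d') ] (localHSign (d +ℕ d') F * hscRestr Γ×Γ' F x)
      ≡⟨ sumOver-cubeFaces-+ d d' _ ⟩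
    ∑[ F ∈ cubeFaces d ] ∑[ F' ∈ cubeFaces d' ]
      (localHSign (d +ℕ d') (F ++ F') * hscRestr Γ×Γ' (F ++ F') x)
      ≡⟨ sumOver-cong (cubeFaces d) (λ F → sumOver-cong (cubeFaces d') (λ F' →
           trans (cong₂ _*_ (localHSign-++ F F') (hscRestr-product F F'))
                 (*-interchange (localHSign d F) _ _ _))) ⟩
    ∑[ F ∈ cubeFaces d ] ∑[ F' ∈ cubeFaces d' ]
      ((localHSign d F * hscRestr Γ F x) * (localHSign d' F' * hscRestr Γ' F' x))
      ≡⟨ sumOver-*-sumOver (cubeFaces d) (cubeFaces d') _ _ ⟩
    localH Γ x * localH Γ' x
      ∎
    where open ≡-Reasoning

proposition3p5 : (IsBall : BallPredicate) (d d' : ℕ)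
    (Γ : CubicalSubdivision IsBall d) (Γ' : CubicalSubdivision IsBall d') →
    ∀ (x : ℤ) →
    localH (productData (toCarrierData Γ) (toCarrierData Γ')) x
      ≡ localH (toCarrierData Γ) x * localH (toCarrierData Γ') x
proposition3p5 IsBall d d' Γ Γ' =
  localH-product (toCarrierData Γ) (toCarrierData Γ')
    (CubicalSubdivision.dim-carrier Γ) (CubicalSubdivision.dim-carrier Γ')
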